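{- Let $n>2$, let $\lambda=(\lambda_1,\ldots,\lambda_n)$ be a weakly decreasing partition and $\alpha=\lambda+\rho$ with $\rho=(n-1,n-2,\ldots,1,0)$ (for a partition $\mu$ of length $m$, $\mu-\rho$ means $\mu-(m-1,\ldots,1,0)$). For a partition $\kappa=(\kappa_1,\ldots,\kappa_m)$ write $\hat\kappa=(\kappa_2,\ldots,\kappa_m)$ and $\check\kappa=(\kappa_3,\ldots,\kappa_m)$. For a weakly decreasing $\kappa$ of length $m$, the Hall–Littlewood polynomial is $$P_\kappa(x;t)=\sum_{\sigma\in S_m}\sigma\Big(x^\kappa\prod_{1\le a<b\le m}\frac{x_a-tx_b}{x_a-x_b}\Big).$$ For a strictly decreasing $\beta$ of length $m$, $GT_2(\beta)$ is the set of partitions $\mu$ of length $m-1$ with $\beta_i\ge\mu_i\ge\beta_{i+1}$ for all $i$ (and $GT_2(\beta)=\{\emptyset\}$ if $m=1$). Let $\zeta_i$ be the substitution $x_k\mapsto x_{k+1}$ for all $k\ge i$, $\zeta=\zeta_1$, and $\zeta_{i,j}=\zeta_j\zeta_i$ for $i<j$ (also written $\zeta_{j,i}$). Let $M(\beta;\mu)$ be coefficients (in the paper, certain determinants built from the two rows $\beta,\mu$) satisfying the inductive hypotheses $$P_{\hat\lambda}(x;t)\prod_{a=2}^{n-1}(x_1-qx_a)=\sum_{\mu\in GT_2(\hat\alpha)}M(\hat\alpha;\mu)\,x_1^{|\hat\alpha|-|\mu|}\,\zeta\big(P_{\mu-\rho}(x;t)\big),$$ $$P_{\check\lambda}(x;t)\prod_{a=2}^{n-2}(x_1-qx_a)=\sum_{\mu\in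 GT_2(\check\alpha)}M(\check\alpha;\mu)\,x_1^{|\check\alpha|-|\mu|}\,\zeta\big(P_{\mu-\rho}(x;t)\big).$$ For non-negative integers $u,v$ define $$F_{\hat\lambda}(u)=\sum_{\mu\in GT_2(\hat\alpha)}M(\hat\alpha;\mu)\,x_1^{|\hat\alpha|-|\mu|}\,\zeta\big(P_{(u,\mu-\rho)}(x;t)\big),\qquad F_{\check\lambda}(u,v)=\sum_{\mu\in GT_2(\check\alpha)}M(\check\alpha;\mu)\,x_1^{|\check\alpha|-|\mu|}\,\zeta\big(P_{(u,v,\mu-\rho)}(x;t)\big),$$ where $(u,\mu-\rho)$ denotes concatenation. Then $$F_{\hat\lambda}(u)=\sum_{2\le i\le n}x_i^{u}\prod_{\substack{1\le a\le n\\ a\ne 1,i}}\frac{x_i-tx_a}{x_i-x_a}\;\zeta_i\big(P_{\hat\lambda}(x;t)\big)\prod_{\substack{1\le a\le n\\ a\ne 1,i}}(x_1-qx_a),$$ and $$F_{\check\lambda}(u,v)=\sum_{2\le i\le n}\sum_{\substack{2\le j\le n\\ j\ne i}}x_i^{u}x_j^{v}\prod_{\substack{1\le a\le n\\ a\ne 1,i}}\frac{x_i-tx_a}{x_i-x_a}\prod_{\substack{1\le a\le n\\ a\ne 1,i,j}}\frac{x_j-tx_a}{x_j-x_a}\;\zeta_{i,j}\big(P_{\check\lambda}(x;t)\big)\prod_{\substack{1\le a\le n\\ a\ne 1,i,j}}(x_1-qx_a).$$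
   Context: This lemma is a step in the inductive proof of a Tokuyama-type recursion for $\prod_{a<b}(x_a-qx_b)\cdot P_\lambda(x;t)$; the two displayed inductive hypotheses are the induction assumptions for partitions of length $n-1$ and $n-2$. -}

module Defs where

open import Level using (Level; suc; _⊔_)
open import Data.Nat as ℕ using (ℕ; zero; _∸_)
import Data.Nat as Nat
open import Data.Fin as Fin using (Fin)
open import Data.Vec as Vec using (Vec; []; _∷_; lookup; removeAt; zipWith)
open import Data.List as List using (List)
open import Algebra.Bundles using (CommutativeRing)
open import Relation.Nullary using (¬_)

record Field (c ℓ : Level) : Set (Level.suc (c ⊔ ℓ)) where
  field
    commutativeRing : CommutativeRing c ℓ
  open CommutativeRing commutativeRing public
  field
    _⁻¹      : Carrier → Carrier
    0≉1      : ¬ (0# ≈ 1#)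
    ⁻¹-inverse : ∀ x → ¬ (x ≈ 0#) → x * (x ⁻¹) ≈ 1#

rho : (m : ℕ) → Vec ℕ m
rho zero        = []
rho (Nat.suc m) = m ∷ rho m

_+ρ : ∀ {m} → Vec ℕ m → Vec ℕ m
_+ρ {m} κ = zipWith Nat._+_ κ (rho m)

_-ρ : ∀ {m} → Vec ℕ m → Vec ℕ m
_-ρ {m} κ = zipWith _∸_ κ (rho m)

∣_∣ : ∀ {m} → Vec ℕ m → ℕ
∣ κ ∣ = Vec.sum κ

WeaklyDecreasing : ∀ {m} → Vec ℕ m → Set
WeaklyDecreasing {m} κ = ∀ (i j : Fin m) → i Fin.≤ j → lookup κ j Nat.≤ lookup κ i

range : ℕ → ℕ → List ℕ
range b' b = List.map (b' Nat.+_) (List.upTo (Nat.suc (b ∸ b')))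

GT₂ : ∀ {m} → Vec ℕ (Nat.suc m) → List (Vec ℕ m)
GT₂ (b ∷ [])      = [] List.∷ List.[]
GT₂ (b ∷ b' ∷ bs) =
  List.concatMap (λ k → List.map (k ∷_) (GT₂ (b' ∷ bs))) (range b' b)

-- All rearrangements (x_{σ(1)}, …, x_{σ(m)}) of a vector, σ ∈ S_m
-- (one entry per permutation σ).
insertAll : ∀ {a} {A : Set a} {m} → A → Vec A m → List (Vec A (Nat.suc m))
insertAll a []       = (a ∷ []) List.∷ List.[]
insertAll a (y ∷ ys) = (a ∷ y ∷ ys) List.∷ List.map (y ∷_) (insertAll a ys)

perms : ∀ {a} {A : Set a} {m} → Vec A m → List (Vec A m)
perms []       = [] List.∷ List.[]
perms (y ∷ ys) = List.concatMap (insertAll y) (perms ys)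

module FieldOps {c ℓ} (K : Field c ℓ) where
  open Field K

  _/_ : Carrier → Carrier → Carrier
  x / y = x * (y ⁻¹)

  _^_ : Carrier → ℕ → Carrier
  x ^ zero      = 1#
  x ^ Nat.suc k = x * (x ^ k)

  ΣL : List Carrier → Carrier
  ΣL = List.foldr _+_ 0#

  ΠL : List Carrier → Carrier
  ΠL = List.foldr _*_ 1#

  ΣV : ∀ {m} → Vec Carrier m → Carrier
  ΣV = Vec.foldr _ _+_ 0#

  ΠV : ∀ {m} → Vec Carrier m → Carrier
  ΠV = Vec.foldr _ _*_ 1#

  ΣFin : (m : ℕ) → (Fin m → Carrier) → Carrier
  ΣFin m f = ΣL (List.map f (List.allFin m))

  Distinct : ∀ {m} → Vec Carrier m → Set ℓ
  Distinct {m} x = ∀ (a b : Fin m) → ¬ (a ≡ b) → ¬ (lookup x a ≈ lookup x b)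
    where open import Relation.Binary.PropositionalEquality using (_≡_)

  monomial : ∀ {m} → Vec ℕ m → Vec Carrier m → Carrier
  monomial κ x = ΠV (zipWith _^_ x κ)

  vandermondeRatio : Carrier → ∀ {m} → Vec Carrier m → Carrier
  vandermondeRatio t []       = 1#
  vandermondeRatio t (y ∷ ys) =
    ΠV (Vec.map (λ z → (y - t * z) / (y - z)) ys) * vandermondeRatio t ys

  HL : Carrier → ∀ {m} → Vec ℕ m → Vec Carrier m → Carrier
  HL t κ x = ΣL (List.map (λ y → monomial κ y * vandermondeRatio t y) (perms x))

-- A permutation of (x₁, …, x_k) is determined by its first entry xᵢ together with a
-- permutation of the remaining entries, so P_{(u,κ)}(x;t) expands along its first part as
-- ∑ᵢ xᵢ^u ∏_{a≠i} (xᵢ - t xₐ)/(xᵢ - xₐ) · P_κ(x without xᵢ; t).  Expanding F_λ̂(u) this way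
-- leaves exactly the right-hand side of the first inductive hypothesis in the variables
-- (x₁, x without xᵢ), which is substituted.  For F_λ̌(u,v) the expansion is done twice,
-- first along u and then along v, before substituting the second hypothesis.
module Submission where

open import Defs
open import Data.Nat using (ℕ; zero; suc; _∸_)
open import Data.Fin using (Fin; zero; suc; punchIn)
open import Data.Fin.Properties using (punchIn-injective)
open import Data.Vec as Vec using (Vec; []; _∷_; lookup; removeAt; map; tail)
open import Data.List as List using (List; []; _∷_; _++_; concatMap; allFin)
open import Data.List.Properties using (map-∘; map-tabulate)
open import Data.List.Relation.Unary.All as All using (All; []; _∷_)
open import Data.List.Relation.Unary.All.Properties using (map⁺; concat⁺)
open import Data.Product using (_×_; _,_)
open import Relation.Binary.PropositionalEquality as ≡ using (_≡_)
open import Function using (_∘_)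
open import Algebra.Bundles using (CommutativeMonoid; Semiring)
import Algebra.Properties.CommutativeSemigroup as CommutativeSemigroupProperties
import Relation.Binary.Reasoning.Setoid as SetoidReasoning

lookup-removeAt : ∀ {a} {A : Set a} {k} (xs : Vec A (suc k)) i j →
                  lookup (removeAt xs i) j ≡ lookup xs (punchIn i j)
lookup-removeAt (x ∷ xs)     zero    j       = ≡.refl
lookup-removeAt (x ∷ y ∷ xs) (suc i) zero    = ≡.refl
lookup-removeAt (x ∷ y ∷ xs) (suc i) (suc j) = lookup-removeAt (y ∷ xs) i j

module CommutativeMonoidSums {c ℓ} (M : CommutativeMonoid c ℓ) where
  open CommutativeMonoid M
  open SetoidReasoning setoid

  ∑ : List Carrier → Carrier
  ∑ = List.foldr _∙_ ε

  ∑Fin : (n : ℕ) → (Fin n → Carrier) → Carrier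
  ∑Fin n f = ∑ (List.map f (allFin n))

  ∑V : ∀ {k} → Vec Carrier k → Carrier
  ∑V = Vec.foldr (λ _ → Carrier) _∙_ ε

  module _ {a} {A : Set a} where

    ∑-cong-All : ∀ {f g : A → Carrier} {l} → All (λ x → f x ≈ g x) l →
                 ∑ (List.map f l) ≈ ∑ (List.map g l)
    ∑-cong-All []       = refl
    ∑-cong-All (e ∷ es) = ∙-cong e (∑-cong-All es)

    ∑-cong : ∀ {f g : A → Carrier} l → (∀ x → f x ≈ g x) →
             ∑ (List.map f l) ≈ ∑ (List.map g l)
    ∑-cong l e = ∑-cong-All (All.universal e l)

    ∑-++ : ∀ (f : A → Carrier) l₁ l₂ →
           ∑ (List.map f (l₁ ++ l₂)) ≈ ∑ (List.map f l₁) ∙ ∑ (List.map f l₂)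
    ∑-++ f []       l₂ = sym (identityˡ _)
    ∑-++ f (x ∷ l₁) l₂ = trans (∙-congˡ (∑-++ f l₁ l₂)) (sym (assoc _ _ _))

    ∑-distrib-∙ : ∀ (f g : A → Carrier) l →
                  ∑ (List.map (λ x → f x ∙ g x) l) ≈ ∑ (List.map f l) ∙ ∑ (List.map g l)
    ∑-distrib-∙ f g []      = sym (identityˡ _)
    ∑-distrib-∙ f g (x ∷ l) =
      trans (∙-congˡ (∑-distrib-∙ f g l)) (interchange (f x) (g x) _ _)
      where open CommutativeSemigroupProperties commutativeSemigroup using (interchange)

    ∑-ε : ∀ (l : List A) → ∑ (List.map (λ _ → ε) l) ≈ ε
    ∑-ε []      = refl
    ∑-ε (x ∷ l) = trans (identityˡ _) (∑-ε l)

  module _ {a b} {A : Set a} {B : Set b} where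

    ∑-map-∘ : ∀ (f : B → Carrier) (g : A → B) l →
              ∑ (List.map f (List.map g l)) ≈ ∑ (List.map (f ∘ g) l)
    ∑-map-∘ f g l = reflexive (≡.cong ∑ (≡.sym (map-∘ l)))

    ∑-concatMap : ∀ (f : B → Carrier) (g : A → List B) l →
                  ∑ (List.map f (concatMap g l)) ≈ ∑ (List.map (λ x → ∑ (List.map f (g x))) l)
    ∑-concatMap f g []      = refl
    ∑-concatMap f g (x ∷ l) = trans (∑-++ f (g x) (concatMap g l)) (∙-congˡ (∑-concatMap f g l))

    ∑-comm : ∀ (f : A → B → Carrier) l₁ l₂ →
             ∑ (List.map (λ x → ∑ (List.map (f x) l₂)) l₁)
             ≈ ∑ (List.map (λ y → ∑ (List.map (λ x → f x y) l₁)) l₂)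
    ∑-comm f []       l₂ = sym (∑-ε l₂)
    ∑-comm f (x ∷ l₁) l₂ =
      trans (∙-congˡ (∑-comm f l₁ l₂)) (sym (∑-distrib-∙ (f x) (λ y → ∑ (List.map (λ x → f x y) l₁)) l₂))

  ∑Fin-cong : ∀ n {f g : Fin n → Carrier} → (∀ i → f i ≈ g i) → ∑Fin n f ≈ ∑Fin n g
  ∑Fin-cong n = ∑-cong (allFin n)

  ∑Fin-suc : ∀ n (f : Fin (suc n) → Carrier) → ∑Fin (suc n) f ≈ f zero ∙ ∑Fin n (f ∘ suc)
  ∑Fin-suc n f = ∙-congˡ (reflexive (≡.cong ∑
    (≡.trans (map-tabulate suc f) (≡.sym (map-tabulate (λ i → i) (f ∘ suc))))))

  module _ {a} {A : Set a} where

    insertAll-preserves-∑V : ∀ {k} (f : A → Carrier) y (p : Vec A k) →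
                             All (λ w → ∑V (map f w) ≈ f y ∙ ∑V (map f p)) (insertAll y p)
    insertAll-preserves-∑V f y [] = refl ∷ []
    insertAll-preserves-∑V f y (z ∷ p) =
      refl ∷ map⁺ (All.map (λ e → trans (∙-congˡ e) (x∙yz≈y∙xz _ _ _)) (insertAll-preserves-∑V f y p))
      where open CommutativeSemigroupProperties commutativeSemigroup using (x∙yz≈y∙xz)

    perms-preserve-∑V : ∀ {k} (f : A → Carrier) (xs : Vec A k) →
                        All (λ w → ∑V (map f w) ≈ ∑V (map f xs)) (perms xs)
    perms-preserve-∑V f []   = refl ∷ []
    perms-preserve-∑V f (y ∷ ys) =
      concat⁺ (map⁺ (All.map (λ e → All.map (λ e′ → trans e′ (∙-congˡ e)) (insertAll-preserves-∑V f y _))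
                             (perms-preserve-∑V f ys)))

    -- A permutation of y ∷ p is y inserted at the front of a permutation p, or at a later position.
    ∑-perms-byFirst : ∀ {k} (h : Vec A (suc k) → Carrier) (xs : Vec A (suc k)) →
      ∑ (List.map h (perms xs))
      ≈ ∑Fin (suc k) (λ i → ∑ (List.map (λ r → h (lookup xs i ∷ r)) (perms (removeAt xs i))))
    ∑-perms-byFirst {zero}  h (y ∷ []) = sym (identityʳ _)
    ∑-perms-byFirst {suc k} h (y ∷ zs@(_ ∷ _)) = begin
      ∑ (List.map h (perms (y ∷ zs)))
        ≈⟨ ∑-concatMap h (insertAll y) (perms zs) ⟩
      ∑ (List.map (λ p → ∑ (List.map h (insertAll y p))) (perms zs))
        ≈⟨ ∑-cong (perms zs) insertions-split ⟩
      ∑ (List.map (λ p → h (y ∷ p) ∙ laterInsertions p) (perms zs))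
        ≈⟨ ∑-distrib-∙ _ _ (perms zs) ⟩
      ∑ (List.map (λ p → h (y ∷ p)) (perms zs)) ∙ ∑ (List.map laterInsertions (perms zs))
        ≈⟨ ∙-congˡ (∑-perms-byFirst laterInsertions zs) ⟩
      ∑ (List.map (λ p → h (y ∷ p)) (perms zs))
        ∙ ∑Fin (suc k) (λ j → ∑ (List.map (λ r → laterInsertions (lookup zs j ∷ r)) (perms (removeAt zs j))))
        ≈⟨ ∙-congˡ (∑Fin-cong (suc k) λ j → sym (∑-concatMap _ (insertAll y) (perms (removeAt zs j)))) ⟩
      ∑ (List.map (λ p → h (y ∷ p)) (perms zs))
        ∙ ∑Fin (suc k) (λ j → ∑ (List.map (λ r → h (lookup zs j ∷ r)) (perms (y ∷ removeAt zs j))))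
        ≈⟨ sym (∑Fin-suc (suc k) _) ⟩
      ∑Fin (suc (suc k)) (λ i → ∑ (List.map (λ r → h (lookup (y ∷ zs) i ∷ r)) (perms (removeAt (y ∷ zs) i)))) ∎
      where
        laterInsertions : Vec A (suc k) → Carrier
        laterInsertions (w ∷ ws) = ∑ (List.map (λ r → h (w ∷ r)) (insertAll y ws))

        insertions-split : ∀ p → ∑ (List.map h (insertAll y p)) ≈ h (y ∷ p) ∙ laterInsertions p
        insertions-split (w ∷ ws) = ∙-congˡ (∑-map-∘ h (w ∷_) (insertAll y ws))

module SemiringSums {c ℓ} (R : Semiring c ℓ) where
  open Semiring R
  open CommutativeMonoidSums +-commutativeMonoid public

  *-distribˡ-∑ : ∀ {a} {A : Set a} x (f : A → Carrier) l →
                 x * ∑ (List.map f l) ≈ ∑ (List.map (λ y → x * f y) l)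
  *-distribˡ-∑ x f []      = zeroʳ x
  *-distribˡ-∑ x f (y ∷ l) = trans (distribˡ _ _ _) (+-congˡ (*-distribˡ-∑ x f l))

module HallLittlewoodExpansion {c ℓ} (K : Field c ℓ) where
  open Field K hiding (zero)
  open FieldOps K
  open SemiringSums semiring
  open CommutativeMonoidSums *-commutativeMonoid using () renaming (perms-preserve-∑V to perms-preserve-ΠV)
  open CommutativeSemigroupProperties *-commutativeSemigroup using (interchange; x∙yz≈y∙xz)
  open SetoidReasoning setoid

  ratio : Carrier → Carrier → Carrier → Carrier
  ratio t x y = (x - t * y) / (x - y)

  headWeight : ∀ {k} → Carrier → ℕ → Vec Carrier (suc k) → Fin (suc k) → Carrier
  headWeight t u xs i = (lookup xs i ^ u) * ΠV (map (ratio t (lookup xs i)) (removeAt xs i))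

  HL-expandHead : ∀ {k} t u (κ : Vec ℕ k) (xs : Vec Carrier (suc k)) →
    HL t (u ∷ κ) xs ≈ ΣFin (suc k) (λ i → headWeight t u xs i * HL t κ (removeAt xs i))
  HL-expandHead {k} t u κ xs = trans (∑-perms-byFirst _ xs) (∑Fin-cong (suc k) expand)
    where
      expand : ∀ i → ΣL (List.map (λ r → monomial (u ∷ κ) (lookup xs i ∷ r) * vandermondeRatio t (lookup xs i ∷ r))
                                  (perms (removeAt xs i)))
                     ≈ headWeight t u xs i * HL t κ (removeAt xs i)
      expand i = begin
        ΣL (List.map (λ r → (xᵢ ^ u * monomial κ r) * (ΠV (map (ratio t xᵢ) r) * vandermondeRatio t r)) (perms ys))
          ≈⟨ ∑-cong-All (All.map (λ e → *-congˡ (*-congʳ e)) (perms-preserve-ΠV (ratio t xᵢ) ys)) ⟩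
        ΣL (List.map (λ r → (xᵢ ^ u * monomial κ r) * (ΠV (map (ratio t xᵢ) ys) * vandermondeRatio t r)) (perms ys))
          ≈⟨ ∑-cong (perms ys) (λ r → interchange _ _ _ _) ⟩
        ΣL (List.map (λ r → headWeight t u xs i * (monomial κ r * vandermondeRatio t r)) (perms ys))
          ≈⟨ *-distribˡ-∑ _ _ (perms ys) ⟨
        headWeight t u xs i * HL t κ ys ∎
        where
          xᵢ : Carrier
          xᵢ = lookup xs i
          ys : Vec Carrier k
          ys = removeAt xs i

  ∑-HL-expandHead : ∀ {k b} {X : Set b} (Ls : List X) (coeff : X → Carrier) (κ : X → Vec ℕ k) t u
                    (xs : Vec Carrier (suc k)) →
    ΣL (List.map (λ μ → coeff μ * HL t (u ∷ κ μ) xs) Ls)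
    ≈ ΣFin (suc k) (λ i → headWeight t u xs i * ΣL (List.map (λ μ → coeff μ * HL t (κ μ) (removeAt xs i)) Ls))
  ∑-HL-expandHead {k} Ls coeff κ t u xs = begin
    ΣL (List.map (λ μ → coeff μ * HL t (u ∷ κ μ) xs) Ls)
      ≈⟨ ∑-cong Ls (λ μ → *-congˡ (HL-expandHead t u (κ μ) xs)) ⟩
    ΣL (List.map (λ μ → coeff μ * ΣFin (suc k) (λ i → w i * HL t (κ μ) (ys i))) Ls)
      ≈⟨ ∑-cong Ls (λ μ → *-distribˡ-∑ _ _ (allFin (suc k))) ⟩
    ΣL (List.map (λ μ → ΣFin (suc k) (λ i → coeff μ * (w i * HL t (κ μ) (ys i)))) Ls)
      ≈⟨ ∑-comm (λ μ i → coeff μ * (w i * HL t (κ μ) (ys i))) Ls (allFin (suc k)) ⟩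
    ΣFin (suc k) (λ i → ΣL (List.map (λ μ → coeff μ * (w i * HL t (κ μ) (ys i))) Ls))
      ≈⟨ ∑Fin-cong (suc k) (λ i → ∑-cong Ls (λ μ → x∙yz≈y∙xz _ _ _)) ⟩
    ΣFin (suc k) (λ i → ΣL (List.map (λ μ → w i * (coeff μ * HL t (κ μ) (ys i))) Ls))
      ≈⟨ ∑Fin-cong (suc k) (λ i → *-distribˡ-∑ _ _ Ls) ⟨
    ΣFin (suc k) (λ i → w i * ΣL (List.map (λ μ → coeff μ * HL t (κ μ) (ys i)) Ls)) ∎
    where
      w : Fin (suc k) → Carrier
      w = headWeight t u xs
      ys : Fin (suc k) → Vec Carrier k
      ys = removeAt xs

  Distinct-removeAt : ∀ {k} (xs : Vec Carrier (suc k)) i → Distinct xs → Distinct (removeAt xs i)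
  Distinct-removeAt xs i distinct a b a≢b lookups≈ =
    distinct (punchIn i a) (punchIn i b) (a≢b ∘ punchIn-injective i a b)
      (≡.subst₂ _≈_ (lookup-removeAt xs i a) (lookup-removeAt xs i b) lookups≈)

  Distinct-∷-removeAt : ∀ {k} x (xs : Vec Carrier (suc k)) i → Distinct (x ∷ xs) → Distinct (x ∷ removeAt xs i)
  Distinct-∷-removeAt x xs@(_ ∷ _) i = Distinct-removeAt (x ∷ xs) (suc i)

  ∑-HL-expandHead-by : ∀ {k b} {X : Set b} (Ls : List X) (coeff : X → Carrier) (κ : X → Vec ℕ k) t u
                       x₁ (R : Vec Carrier k → Carrier) →
    (∀ ys → Distinct (x₁ ∷ ys) → R ys ≈ ΣL (List.map (λ μ → coeff μ * HL t (κ μ) ys) Ls)) →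
    ∀ xs → Distinct (x₁ ∷ xs) →
    ΣL (List.map (λ μ → coeff μ * HL t (u ∷ κ μ) xs) Ls)
    ≈ ΣFin (suc k) (λ i → headWeight t u xs i * R (removeAt xs i))
  ∑-HL-expandHead-by {k} Ls coeff κ t u x₁ R R≈ xs distinct =
    trans (∑-HL-expandHead Ls coeff κ t u xs)
          (∑Fin-cong (suc k) λ i → *-congˡ (sym (R≈ _ (Distinct-∷-removeAt x₁ xs i distinct))))

  regroup : ∀ a b c d g p → (a * b) * ((c * d) * (g * p)) ≈ ((((a * c) * b) * d) * g) * p
  regroup a b c d g p = begin
    (a * b) * ((c * d) * (g * p)) ≈⟨ *-assoc _ _ _ ⟨
    ((a * b) * (c * d)) * (g * p) ≈⟨ *-congʳ (interchange a b c d) ⟩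
    ((a * c) * (b * d)) * (g * p) ≈⟨ *-congʳ (*-assoc _ _ _) ⟨
    (((a * c) * b) * d) * (g * p) ≈⟨ *-assoc _ _ _ ⟨
    ((((a * c) * b) * d) * g) * p ∎

mainTheorem4 : ∀ {c ℓ} (K : Field c ℓ) → let open Field K in let open FieldOps K in
  (t q : Carrier)
  (M : (m : ℕ) → Vec ℕ (suc m) → Vec ℕ m → Carrier)
  (m : ℕ) (λ′ : Vec ℕ (suc (suc (suc m)))) → WeaklyDecreasing λ′ →
  let α = λ′ +ρ
      λ̂ = tail λ′
      α̂ = tail α
      λ̌ = tail λ̂
      α̌ = tail α̂
  in
  (∀ (x₁ : Carrier) (xs : Vec Carrier (suc m)) → Distinct (x₁ ∷ xs) →
     HL t λ̂ (x₁ ∷ xs) * ΠV (map (λ y → x₁ - q * y) xs)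
     ≈ ΣL (List.map (λ μ → M (suc m) α̂ μ * (x₁ ^ (∣ α̂ ∣ ∸ ∣ μ ∣)) * HL t (μ -ρ) xs)
                    (GT₂ α̂))) →
  (∀ (x₁ : Carrier) (xs : Vec Carrier m) → Distinct (x₁ ∷ xs) →
     HL t λ̌ (x₁ ∷ xs) * ΠV (map (λ y → x₁ - q * y) xs)
     ≈ ΣL (List.map (λ μ → M m α̌ μ * (x₁ ^ (∣ α̌ ∣ ∸ ∣ μ ∣)) * HL t (μ -ρ) xs)
                    (GT₂ α̌))) →
  (∀ (x₁ : Carrier) (xs : Vec Carrier (suc (suc m))) → Distinct (x₁ ∷ xs) →
    (∀ (u : ℕ) →
       ΣL (List.map (λ μ → M (suc m) α̂ μ * (x₁ ^ (∣ α̂ ∣ ∸ ∣ μ ∣)) * HL t (u ∷ (μ -ρ)) xs)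
                    (GT₂ α̂))
       ≈ ΣFin (suc (suc m)) (λ i →
           let xi = lookup xs i
               ys = removeAt xs i
           in (xi ^ u)
              * ΠV (map (λ y → (xi - t * y) / (xi - y)) ys)
              * HL t λ̂ (x₁ ∷ ys)
              * ΠV (map (λ y → x₁ - q * y) ys)))
    ×
    (∀ (u v : ℕ) →
       ΣL (List.map (λ μ → M m α̌ μ * (x₁ ^ (∣ α̌ ∣ ∸ ∣ μ ∣)) * HL t (u ∷ v ∷ (μ -ρ)) xs)
                    (GT₂ α̌))
       ≈ ΣFin (suc (suc m)) (λ i →
           let xi = lookup xs i
               ys = removeAt xs i
           in ΣFin (suc m) (λ j →
                let xj = lookup ys j
                    zs = removeAt ys j
                in (xi ^ u) * (xj ^ v)
                   * ΠV (map (λ y → (xi - t * y) / (xi - y)) ys)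
                   * ΠV (map (λ y → (xj - t * y) / (xj - y)) zs)
                   * HL t λ̌ (x₁ ∷ zs)
                   * ΠV (map (λ y → x₁ - q * y) zs)))))
mainTheorem4 K t q M m λ′ _ iĥ ih̄ x₁ xs distinct =
  (λ u → trans
     (∑-HL-expandHead-by (GT₂ α̂) (coeff α̂) _-ρ t u x₁ (λ ys → HL t λ̂ (x₁ ∷ ys) * Q ys) (iĥ x₁) xs distinct)
     (∑Fin-cong (suc (suc m)) λ _ → sym (*-assoc _ _ _)))
  ,
  (λ u v → trans
     (∑-HL-expandHead-by (GT₂ α̌) (coeff α̌) (λ μ → v ∷ (μ -ρ)) t u x₁
        (λ ys → ΣFin (suc m) (λ j → headWeight t v ys j * (HL t λ̌ (x₁ ∷ removeAt ys j) * Q (removeAt ys j))))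
        (λ ys → sym ∘ ∑-HL-expandHead-by (GT₂ α̌) (coeff α̌) _-ρ t v x₁ (λ zs → HL t λ̌ (x₁ ∷ zs) * Q zs) (ih̄ x₁) ys)
        xs distinct)
     (∑Fin-cong (suc (suc m)) λ _ →
        trans (*-distribˡ-∑ _ _ (allFin (suc m))) (∑Fin-cong (suc m) λ _ → regroup _ _ _ _ _ _)))
  where
    open Field K hiding (zero)
    open FieldOps K
    open HallLittlewoodExpansion K
    open SemiringSums semiring using (∑Fin-cong; *-distribˡ-∑)
    α̂ λ̂ : Vec ℕ (suc (suc m))
    α̂ = tail (λ′ +ρ)
    λ̂ = tail λ′
    α̌ λ̌ : Vec ℕ (suc m)
    α̌ = tail α̂
    λ̌ = tail λ̂
    coeff : ∀ {k} → Vec ℕ (suc k) → Vec ℕ k → Carrier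
    coeff {k} β μ = M k β μ * (x₁ ^ (∣ β ∣ ∸ ∣ μ ∣))
    Q : ∀ {k} → Vec Carrier k → Carrier
    Q ys = ΠV (map (λ y → x₁ - q * y) ys)
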